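{- Let $a$ be an approximate normal form, $\Gamma$ a typing environment and $\sigma$ a type of system $\mathcal H$. Then $a\Vdash\mathtt T(\Gamma,\sigma)$ is derivable in the inhabitation algorithm for $\mathcal H$ if and only if there exists a derivation $\Pi\triangleright\Gamma\vdash_{\mathcal H} a:\sigma$ with $a=\mathcal A(\Pi)$.
   Context: Types: $\sigma,\tau,\rho::=\alpha\mid A\to\tau$, $\alpha$ ranging over a countable set of base types, multiset types $A=[\sigma_i]_{i\in I}$ finite possibly empty multisets of types ($[\,]$ empty). Typing environments $\Gamma$ map variables to multiset types, all but finitely many to $[\,]$; $\mathrm{dom}(\Gamma)=\{x:\Gamma(x)\ne[\,]\}$; $\emptyset$ has empty domain; $(\Gamma+\Delta)(x)=\Gamma(x)\uplus\Delta(x)$, $+_{i\in I}\Delta_i$ its $n$-ary version; $\Gamma\setminus x$ maps $x$ to $[\,]$, agreeing with $\Gamma$ elsewhere; $x{:}A$ is the environment mapping $x$ to $A$ and all others to $[\,]$. System $\mathcal H$: (var) $x{:}[\rho]\vdash x:\rho$; ($\to$I) from $\Gamma\vdash t:\tau$ infer $\Gamma\setminus x\vdash\lambda x.t:\Gamma(x)\to\tau$; (m) from $(\Delta_i\vdash t:\sigma_i)_{i\in I}$, $I$ finite possibly empty, infer $+_{i\in I}\Delta_i\vdash t:[\sigma_i]_{i\in I}$; ($\to$E) from $\Gamma\vdash t:A\to\tau$, $\Delta\vdash u:A$ infer $\Gamma+\Delta\vdash tu:\tau$. These rules apply to approximate normal forms, $\Omega$ being typable only by (m) with $I=\emptyset$.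 Approximate normal forms: $a::=\Omega\mid N$, $N::=\lambda x.N\mid L$, $L::=x\mid L\,a$, $\Omega$ a constant. $\le$ is the smallest order compatible with the constructors such that $\Omega\le a$ for all $a$; $\bigvee$ is least upper bound; $\uparrow_{i\in I}a_i$ means $\bigvee_{i\in I} a_i$ exists. For a derivation $\Pi$ whose subject is an approximate normal form, its approximant $\mathcal A(\Pi)$ is: $x$ if $\Pi$ is (var) with subject $x$; $\lambda x.\mathcal A(\Pi')$ if the last rule is ($\to$I) with premise $\Pi'$; $\mathcal A(\Pi')\mathcal A(\Pi'')$ if the last rule is ($\to$E) with premises $\Pi'$ (function) and $\Pi''$ (argument); $\bigvee_{i\in I}\mathcal A(\Pi_i)$ if the last rule is (m) with premises $(\Pi_i)_{i\in I}$ ($\Omega$ when $I=\emptyset$). Equivalently it is the subject with every maximal subterm not typed in $\Pi$ replaced by $\Omega$. Inhabitation algorithm for $\mathcal H$ (judgements $a\Vdash\mathtt T(\Gamma,\sigma)$, $a\Vdash\mathtt{TI}(\Gamma,A)$, $a\Vdash\mathtt H^{x:[\rho]}(\Gamma,\tau)$): (Abs) from $a\Vdash\mathtt T(\Gamma+x{:}A,\tau)$, $x\notin\mathrm{dom}(\Gamma)$, infer $\lambda x.a\Vdash\mathtt T(\Gamma,A\to\tau)$; (Union) from $(a_i\Vdash\mathtt T(\Gamma_i,\sigma_i))_{i\in I}$ and $\uparrow_{i\in I}a_i$ infer $\bigvee_{i\in I}a_i\Vdash\mathtt{TI}(+_{i\in I}\Gamma_i,[\sigma_i]_{i\in I})$;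 (Head$_{>0}$) from $\Gamma=\Gamma_1+\Gamma_2$, $a\Vdash\mathtt H^{x:[A_1\to\dots\to A_n\to B\to\tau]}(\Gamma_1,B\to\tau)$, $b\Vdash\mathtt{TI}(\Gamma_2,B)$, $n\ge0$, infer $ab\Vdash\mathtt H^{x:[A_1\to\dots\to A_n\to B\to\tau]}(\Gamma,\tau)$; (Head$_0$) $x\Vdash\mathtt H^{x:[\tau]}(\emptyset,\tau)$; (Head) from $a\Vdash\mathtt H^{x:[A_1\to\dots\to A_n\to\tau]}(\Gamma,\tau)$ infer $a\Vdash\mathtt T(\Gamma+x{:}[A_1\to\dots\to A_n\to\tau],\tau)$. -}

module Defs where

open import Data.Nat using (ℕ; _≤_; _≟_)
open import Data.List using (List; []; _∷_; _++_; map; foldr; [_])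
open import Data.List.Relation.Unary.All using (All)
open import Data.Product using (Σ; ∃; _×_; _,_; proj₁; proj₂)
open import Data.Bool using (if_then_else_)
open import Relation.Nullary.Decidable using (⌊_⌋)
open import Relation.Binary.PropositionalEquality using (_≡_)

-- Types of system H.  Multiset types are represented by lists, and are
-- compared up to the multiset equivalence _≈ᵐ_ defined below (which in
-- turn compares elements up to _≈ᵗ_).

Var : Set
Var = ℕ

data Ty : Set where
  base : ℕ → Ty
  _⇒_  : List Ty → Ty → Ty

infixr 5 _⇒_

MTy : Set
MTy = List Ty

mutual
  data _≈ᵗ_ : Ty → Ty → Set where
    base≈ : ∀ {α} → base α ≈ᵗ base α
    arr≈  : ∀ {A B σ τ} → A ≈ᵐ B → σ ≈ᵗ τ → (A ⇒ σ) ≈ᵗ (B ⇒ τ)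

  data _≈ᵐ_ : MTy → MTy → Set where
    []≈   : [] ≈ᵐ []
    cons≈ : ∀ {σ τ A B C} → σ ≈ᵗ τ → A ≈ᵐ (B ++ C) → (σ ∷ A) ≈ᵐ (B ++ τ ∷ C)

Env : Set
Env = Var → MTy

_≈ᵉ_ : Env → Env → Set
Γ ≈ᵉ Δ = ∀ x → Γ x ≈ᵐ Δ x

∅ : Env
∅ _ = []

_+ᵉ_ : Env → Env → Env
(Γ +ᵉ Δ) x = Γ x ++ Δ x

infixl 6 _+ᵉ_

sumᵉ : List Env → Env
sumᵉ = foldr _+ᵉ_ ∅

_∖_ : Env → Var → Env
(Γ ∖ x) y = if ⌊ x ≟ y ⌋ then [] else Γ y

_∶ᵉ_ : Var → MTy → Env
(x ∶ᵉ A) y = if ⌊ x ≟ y ⌋ then A else []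

FinSupp : Env → Set
FinSupp Γ = ∃ λ n → ∀ x → n ≤ x → Γ x ≡ []

mutual
  data ANF : Set where
    Ω  : ANF
    nf : NF → ANF

  data NF : Set where
    lam : Var → NF → NF
    neu : Ne → NF

  data Ne : Set where
    var : Var → Ne
    app : Ne → ANF → Ne

mutual
  data _≤ᵃ_ : ANF → ANF → Set where
    Ω≤  : ∀ {a} → Ω ≤ᵃ a
    nf≤ : ∀ {N N'} → N ≤ⁿ N' → nf N ≤ᵃ nf N'

  data _≤ⁿ_ : NF → NF → Set where
    lam≤ : ∀ {x N N'} → N ≤ⁿ N' → lam x N ≤ⁿ lam x N'
    neu≤ : ∀ {L L'} → L ≤ˡ L' → neu L ≤ⁿ neu L'

  data _≤ˡ_ : Ne → Ne → Set where
    var≤ : ∀ {x} → var x ≤ˡ var x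
    app≤ : ∀ {L L' a a'} → L ≤ˡ L' → a ≤ᵃ a' → app L a ≤ˡ app L' a'

IsLub : List ANF → ANF → Set
IsLub as b = All (_≤ᵃ b) as × (∀ c → All (_≤ᵃ c) as → b ≤ᵃ c)

-- System H on approximate normal forms.
-- Equations between environments / multiset types in conclusions are
-- multiset equalities, hence expressed with _≈ᵉ_ / _≈ᵐ_.

mutual
  data _⊢_∶_ : Env → ANF → Ty → Set where
    var  : ∀ {Γ x ρ} → Γ ≈ᵉ (x ∶ᵉ [ ρ ]) → Γ ⊢ nf (neu (var x)) ∶ ρ
    →I   : ∀ {Γ Γ' x N τ} → Γ ⊢ nf N ∶ τ → Γ' ≈ᵉ (Γ ∖ x) →
           Γ' ⊢ nf (lam x N) ∶ (Γ x ⇒ τ)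
    →E   : ∀ {Γ Δ Θ L a A τ} → Γ ⊢ nf (neu L) ∶ (A ⇒ τ) → Δ ⊢ₘ a ∶ A →
           Θ ≈ᵉ (Γ +ᵉ Δ) → Θ ⊢ nf (neu (app L a)) ∶ τ

  data _⊢ₘ_∶_ : Env → ANF → MTy → Set where
    m : ∀ {Γ t A} (ps : List (Env × Ty)) → Fam t ps →
        Γ ≈ᵉ sumᵉ (map proj₁ ps) → A ≈ᵐ map proj₂ ps → Γ ⊢ₘ t ∶ A

  data Fam (t : ANF) : List (Env × Ty) → Set where
    []  : Fam t []
    _∷_ : ∀ {Δ σ ps} → Δ ⊢ t ∶ σ → Fam t ps → Fam t ((Δ , σ) ∷ ps)

-- The approximant 𝒜(Π), given as a relation "Apx Π b" meaning b = 𝒜(Π)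
-- (the join in rule (m) is partial, hence a relation; it is functional
-- since least upper bounds are unique).
mutual
  Apx : ∀ {Γ a σ} → Γ ⊢ a ∶ σ → ANF → Set
  Apx (var {x = x} _) b = b ≡ nf (neu (var x))
  Apx (→I {x = x} Π _) b = Σ NF λ N → Apx Π (nf N) × b ≡ nf (lam x N)
  Apx (→E Π Π' _) b = Σ Ne λ L → Σ ANF λ c →
    Apx Π (nf (neu L)) × ApxM Π' c × b ≡ nf (neu (app L c))

  ApxM : ∀ {Γ a A} → Γ ⊢ₘ a ∶ A → ANF → Set
  ApxM (m ps F _ _) b = Σ (List ANF) λ bs → ApxF F bs × IsLub bs b

  ApxF : ∀ {t ps} → Fam t ps → List ANF → Set
  ApxF [] bs = bs ≡ []
  ApxF (Π ∷ F) bs = Σ ANF λ b → Σ (List ANF) λ bs' →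
    Apx Π b × ApxF F bs' × bs ≡ b ∷ bs'

data Ends : Ty → Ty → Set where
  here  : ∀ {ρ} → Ends ρ ρ
  there : ∀ {A τ σ} → Ends τ σ → Ends (A ⇒ τ) σ

mutual
  data T : ANF → Env → Ty → Set where
    Abs  : ∀ {N Γ x A τ} → T (nf N) (Γ +ᵉ (x ∶ᵉ A)) τ → Γ x ≡ [] →
           T (nf (lam x N)) Γ (A ⇒ τ)
    Head : ∀ {L x ρ Γ Γ' τ τ'} → H x ρ L Γ τ → Ends ρ τ →
           Γ' ≈ᵉ (Γ +ᵉ (x ∶ᵉ [ ρ ])) → τ' ≈ᵗ τ → T (nf (neu L)) Γ' τ'

  data TI : ANF → Env → MTy → Set where
    Union : ∀ {b Γ A} (ps : List (ANF × Env × Ty)) → TFam ps →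
            IsLub (map proj₁ ps) b →
            Γ ≈ᵉ sumᵉ (map (λ p → proj₁ (proj₂ p)) ps) →
            A ≈ᵐ map (λ p → proj₂ (proj₂ p)) ps → TI b Γ A

  data TFam : List (ANF × Env × Ty) → Set where
    []  : TFam []
    _∷_ : ∀ {a Γ σ ps} → T a Γ σ → TFam ps → TFam ((a , Γ , σ) ∷ ps)

  data H (x : Var) (ρ : Ty) : Ne → Env → Ty → Set where
    Head0  : ∀ {Γ} → Γ ≈ᵉ ∅ → H x ρ (var x) Γ ρ
    Head>0 : ∀ {L b Γ Γ₁ Γ₂ B τ} → Γ ≈ᵉ (Γ₁ +ᵉ Γ₂) → Ends ρ (B ⇒ τ) →
             H x ρ L Γ₁ (B ⇒ τ) → TI b Γ₂ B → H x ρ (app L b) Γ τ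

-- Each rule of the inhabitation algorithm is a rule of system H read
-- backwards on the typed part of the subject: Abs is (→I), Head0 and
-- Head>0 build the spine x a₁ … aₙ of an application by (var) and (→E),
-- and Union is (m).  Soundness translates algorithm derivations into
-- typing derivations; the only subtlety is that (m) types one subject
-- with all its premises, so the derivations of the aᵢ are lifted to their
-- join: typing is monotone in ≤ and lifting keeps the approximant.
-- Completeness runs the translation backwards by induction on Π,
-- producing a derivation for 𝒜(Π); an application is handled by
-- extending the head derivation of its function part.
module Submission where

open import Defs
open import Data.Product using (Σ; _×_; _,_; proj₁; proj₂)
open import Data.Sum using (_⊎_; inj₁; inj₂)
open import Data.List using (List; []; _∷_; _++_; map; [_])
open import Data.List.Properties using (++-assoc; ++-identityʳ; ∷-injective; map-∘)
open import Data.List.Relation.Unary.All using (All; []; _∷_)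
open import Data.Nat using (_≟_)
open import Function.Bundles using (_⇔_; mk⇔)
open import Relation.Nullary using (yes; no; contradiction)
open import Relation.Binary.PropositionalEquality
  using (_≡_; refl; sym; cong; subst; subst₂)

mutual
  ≈ᵗ-refl : ∀ {σ} → σ ≈ᵗ σ
  ≈ᵗ-refl {base α} = base≈
  ≈ᵗ-refl {A ⇒ σ} = arr≈ ≈ᵐ-refl ≈ᵗ-refl

  ≈ᵐ-refl : ∀ {A} → A ≈ᵐ A
  ≈ᵐ-refl {[]} = []≈
  ≈ᵐ-refl {σ ∷ A} = cons≈ {B = []} ≈ᵗ-refl ≈ᵐ-refl

≈ᵐ-reflexive : ∀ {A B} → A ≡ B → A ≈ᵐ B
≈ᵐ-reflexive refl = ≈ᵐ-refl

≈ᵐ-[] : ∀ {A} → [] ≈ᵐ A → A ≡ []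
≈ᵐ-[] []≈ = refl

≈ᵐ-insert : ∀ B₁ {B₂ A τ σ} → (B₁ ++ B₂) ≈ᵐ A → τ ≈ᵗ σ →
  (B₁ ++ τ ∷ B₂) ≈ᵐ (σ ∷ A)
≈ᵐ-insert [] A≈ τ≈σ = cons≈ {B = []} τ≈σ A≈
≈ᵐ-insert (_ ∷ B₁) {σ = σ} (cons≈ {B = C₁} β≈ A≈) τ≈σ =
  cons≈ {B = σ ∷ C₁} β≈ (≈ᵐ-insert B₁ A≈ τ≈σ)

mutual
  ≈ᵗ-sym : ∀ {σ τ} → σ ≈ᵗ τ → τ ≈ᵗ σ
  ≈ᵗ-sym base≈ = base≈
  ≈ᵗ-sym (arr≈ A≈B σ≈τ) = arr≈ (≈ᵐ-sym A≈B) (≈ᵗ-sym σ≈τ)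

  ≈ᵐ-sym : ∀ {A B} → A ≈ᵐ B → B ≈ᵐ A
  ≈ᵐ-sym []≈ = []≈
  ≈ᵐ-sym (cons≈ {B = B₁} σ≈τ A≈B) = ≈ᵐ-insert B₁ (≈ᵐ-sym A≈B) (≈ᵗ-sym σ≈τ)

split-++ : ∀ {X : Set} (E₁ : List X) {E₂ F₁ F₂ : List X} {τ : X} →
  E₁ ++ E₂ ≡ F₁ ++ τ ∷ F₂ →
  (Σ (List X) λ M → E₁ ≡ F₁ ++ τ ∷ M × F₂ ≡ M ++ E₂) ⊎
  (Σ (List X) λ M → E₂ ≡ M ++ τ ∷ F₂ × F₁ ≡ E₁ ++ M)
split-++ [] {F₁ = F₁} eq = inj₂ (F₁ , eq , refl)
split-++ (e ∷ E₁) {F₁ = []} refl = inj₁ (E₁ , refl , refl)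
split-++ (e ∷ E₁) {F₁ = f ∷ F₁} eq with ∷-injective eq
... | refl , eq′ with split-++ E₁ eq′
... | inj₁ (M , p , q) = inj₁ (M , cong (f ∷_) p , q)
... | inj₂ (M , p , q) = inj₂ (M , p , cong (f ∷_) q)

≈ᵐ-remove : ∀ B₁ {τ B₂ C} → (B₁ ++ τ ∷ B₂) ≈ᵐ C →
  Σ (List Ty) λ C₁ → Σ (List Ty) λ C₂ → Σ Ty λ τ′ →
  C ≡ C₁ ++ τ′ ∷ C₂ × τ ≈ᵗ τ′ × (B₁ ++ B₂) ≈ᵐ (C₁ ++ C₂)
≈ᵐ-remove [] (cons≈ {B = E₁} {C = E₂} τ≈ B≈) = E₁ , E₂ , _ , refl , τ≈ , B≈
≈ᵐ-remove (_ ∷ B₁) (cons≈ {τ = β′} {B = E₁} {C = E₂} β≈ B≈) with ≈ᵐ-remove B₁ B≈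
... | F₁ , F₂ , τ′ , eq , τ≈ , B≈′ with split-++ E₁ eq
... | inj₁ (M , refl , refl) =
  F₁ , M ++ β′ ∷ E₂ , τ′ , ++-assoc F₁ (τ′ ∷ M) (β′ ∷ E₂) , τ≈ ,
  subst₂ _≈ᵐ_ refl (++-assoc F₁ M (β′ ∷ E₂))
    (cons≈ {B = F₁ ++ M} β≈ (subst₂ _≈ᵐ_ refl (sym (++-assoc F₁ M E₂)) B≈′))
... | inj₂ (M , refl , refl) =
  E₁ ++ β′ ∷ M , F₂ , τ′ , sym (++-assoc E₁ (β′ ∷ M) (τ′ ∷ F₂)) , τ≈ ,
  subst₂ _≈ᵐ_ refl (sym (++-assoc E₁ (β′ ∷ M) F₂))
    (cons≈ {B = E₁} β≈ (subst₂ _≈ᵐ_ refl (++-assoc E₁ M F₂) B≈′))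

mutual
  ≈ᵗ-trans : ∀ {σ τ ρ} → σ ≈ᵗ τ → τ ≈ᵗ ρ → σ ≈ᵗ ρ
  ≈ᵗ-trans base≈ base≈ = base≈
  ≈ᵗ-trans (arr≈ A≈B σ≈τ) (arr≈ B≈C τ≈ρ) = arr≈ (≈ᵐ-trans A≈B B≈C) (≈ᵗ-trans σ≈τ τ≈ρ)

  ≈ᵐ-trans : ∀ {A B C} → A ≈ᵐ B → B ≈ᵐ C → A ≈ᵐ C
  ≈ᵐ-trans []≈ B≈C = B≈C
  ≈ᵐ-trans (cons≈ {B = B₁} σ≈τ A≈B) B≈C with ≈ᵐ-remove B₁ B≈C
  ... | _ , _ , _ , refl , τ≈τ′ , B≈C′ = cons≈ (≈ᵗ-trans σ≈τ τ≈τ′) (≈ᵐ-trans A≈B B≈C′)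

≈ᵐ-++ʳ : ∀ {A A′} B → A ≈ᵐ A′ → (A ++ B) ≈ᵐ (A′ ++ B)
≈ᵐ-++ʳ B []≈ = ≈ᵐ-refl
≈ᵐ-++ʳ B (cons≈ {τ = τ} {B = B₁} {C = B₂} σ≈τ A≈) =
  subst₂ _≈ᵐ_ refl (sym (++-assoc B₁ (τ ∷ B₂) B))
    (cons≈ {B = B₁} σ≈τ (subst₂ _≈ᵐ_ refl (++-assoc B₁ B₂ B) (≈ᵐ-++ʳ B A≈)))

≈ᵐ-++ˡ : ∀ A {B B′} → B ≈ᵐ B′ → (A ++ B) ≈ᵐ (A ++ B′)
≈ᵐ-++ˡ [] B≈ = B≈
≈ᵐ-++ˡ (σ ∷ A) B≈ = cons≈ {B = []} ≈ᵗ-refl (≈ᵐ-++ˡ A B≈)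

≈ᵐ-++-comm : ∀ A B → (A ++ B) ≈ᵐ (B ++ A)
≈ᵐ-++-comm [] B = ≈ᵐ-reflexive (sym (++-identityʳ B))
≈ᵐ-++-comm (σ ∷ A) B = cons≈ {B = B} ≈ᵗ-refl (≈ᵐ-++-comm A B)

≈ᵐ-++-swapʳ : ∀ A B C → ((A ++ B) ++ C) ≈ᵐ ((A ++ C) ++ B)
≈ᵐ-++-swapʳ A B C =
  ≈ᵐ-trans (≈ᵐ-reflexive (++-assoc A B C))
    (≈ᵐ-trans (≈ᵐ-++ˡ A (≈ᵐ-++-comm B C)) (≈ᵐ-reflexive (sym (++-assoc A C B))))

≈ᵉ-refl : ∀ {Γ} → Γ ≈ᵉ Γ
≈ᵉ-refl _ = ≈ᵐ-refl

≈ᵉ-sym : ∀ {Γ Δ} → Γ ≈ᵉ Δ → Δ ≈ᵉ Γ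
≈ᵉ-sym Γ≈Δ y = ≈ᵐ-sym (Γ≈Δ y)

≈ᵉ-trans : ∀ {Γ Δ Θ} → Γ ≈ᵉ Δ → Δ ≈ᵉ Θ → Γ ≈ᵉ Θ
≈ᵉ-trans Γ≈Δ Δ≈Θ y = ≈ᵐ-trans (Γ≈Δ y) (Δ≈Θ y)

+ᵉ-congʳ : ∀ {Γ Γ′} Δ → Γ ≈ᵉ Γ′ → (Γ +ᵉ Δ) ≈ᵉ (Γ′ +ᵉ Δ)
+ᵉ-congʳ Δ Γ≈ y = ≈ᵐ-++ʳ (Δ y) (Γ≈ y)

+ᵉ-swapʳ : ∀ Γ Δ Θ → ((Γ +ᵉ Δ) +ᵉ Θ) ≈ᵉ ((Γ +ᵉ Θ) +ᵉ Δ)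
+ᵉ-swapʳ Γ Δ Θ y = ≈ᵐ-++-swapʳ (Γ y) (Δ y) (Θ y)

∶ᵉ-at : ∀ x (A : MTy) → (x ∶ᵉ A) x ≡ A
∶ᵉ-at x A with x ≟ x
... | yes _ = refl
... | no x≢x = contradiction refl x≢x

∖-at : ∀ (Δ : Env) x → (Δ ∖ x) x ≡ []
∖-at Δ x with x ≟ x
... | yes _ = refl
... | no x≢x = contradiction refl x≢x

∶ᵉ-cong : ∀ x {A B} → A ≈ᵐ B → (x ∶ᵉ A) ≈ᵉ (x ∶ᵉ B)
∶ᵉ-cong x A≈B y with x ≟ y
... | yes _ = A≈B
... | no _ = []≈

+ᵉ-∶ᵉ-at : ∀ {Γ x} A → Γ x ≡ [] → (Γ +ᵉ (x ∶ᵉ A)) x ≡ A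
+ᵉ-∶ᵉ-at {x = x} A Γx≡[] rewrite Γx≡[] = ∶ᵉ-at x A

+ᵉ-∶ᵉ-∖ : ∀ {Γ x} A → Γ x ≡ [] → Γ ≈ᵉ ((Γ +ᵉ (x ∶ᵉ A)) ∖ x)
+ᵉ-∶ᵉ-∖ {Γ} {x} A Γx≡[] y with x ≟ y
... | yes refl = ≈ᵐ-reflexive Γx≡[]
... | no _ = ≈ᵐ-reflexive (sym (++-identityʳ (Γ y)))

∖-+ᵉ-∶ᵉ : ∀ {Δ x B} → Δ x ≈ᵐ B → Δ ≈ᵉ ((Δ ∖ x) +ᵉ (x ∶ᵉ B))
∖-+ᵉ-∶ᵉ {Δ} {x} Δx≈B y with x ≟ y
... | yes refl = Δx≈B
... | no _ = ≈ᵐ-reflexive (sym (++-identityʳ (Δ y)))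

_⊢_∶_≫_ : Env → ANF → Ty → ANF → Set
Γ ⊢ a ∶ σ ≫ b = Σ (Γ ⊢ a ∶ σ) λ Π → Apx Π b

→I-fresh : ∀ {Θ Γ x A N τ b} → Θ x ≡ [] → Γ ≈ᵉ Θ →
  (Θ +ᵉ (x ∶ᵉ A)) ⊢ nf N ∶ τ ≫ nf b → Γ ⊢ nf (lam x N) ∶ (A ⇒ τ) ≫ nf (lam x b)
→I-fresh {Θ} {Γ} {x} {A} {N} {τ} {b} Θx≡[] Γ≈Θ (Π , apx) =
  subst (λ A′ → Γ ⊢ nf (lam x N) ∶ (A′ ⇒ τ) ≫ nf (lam x b))
    (+ᵉ-∶ᵉ-at {Θ} A Θx≡[])
    (→I Π (≈ᵉ-trans Γ≈Θ (+ᵉ-∶ᵉ-∖ {Θ} A Θx≡[])) , b , apx , refl)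

⊢-resp-≈ : ∀ {Γ Γ′ a b σ σ′} (Π : Γ ⊢ a ∶ σ) → Apx Π b → Γ ≈ᵉ Γ′ → σ ≈ᵗ σ′ →
  Γ′ ⊢ a ∶ σ′ ≫ b
⊢-resp-≈ (var {x = x} Γ≈x) apx Γ≈ σ≈ =
  var (≈ᵉ-trans (≈ᵉ-sym Γ≈) (≈ᵉ-trans Γ≈x (∶ᵉ-cong x (cons≈ {B = []} σ≈ []≈)))) , apx
⊢-resp-≈ (→I {Γ = Δ} {x = x} Π Γ≈Δ∖x) (_ , apx , refl) Γ≈ (arr≈ A≈ τ≈) =
  →I-fresh (∖-at Δ x) (≈ᵉ-trans (≈ᵉ-sym Γ≈) Γ≈Δ∖x)
    (⊢-resp-≈ Π apx (∖-+ᵉ-∶ᵉ A≈) τ≈)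
⊢-resp-≈ (→E Π Π′ Θ≈) (L , c , apx , apx′ , refl) Γ≈ σ≈
  with ⊢-resp-≈ Π apx ≈ᵉ-refl (arr≈ ≈ᵐ-refl σ≈)
... | Π₁ , apx₁ = →E Π₁ Π′ (≈ᵉ-trans (≈ᵉ-sym Γ≈) Θ≈) , L , c , apx₁ , apx′ , refl

mutual
  ⊢-mono : ∀ {Γ a a′ c σ} (Π : Γ ⊢ a ∶ σ) → Apx Π c → a ≤ᵃ a′ → Γ ⊢ a′ ∶ σ ≫ c
  ⊢-mono (var Γ≈) apx (nf≤ (neu≤ var≤)) = var Γ≈ , apx
  ⊢-mono (→I Π Γ≈) (N , apx , refl) (nf≤ (lam≤ N≤)) with ⊢-mono Π apx (nf≤ N≤)
  ... | Π₁ , apx₁ = →I Π₁ Γ≈ , N , apx₁ , refl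
  ⊢-mono (→E Π Π′ Θ≈) (L , c , apx , apx′ , refl) (nf≤ (neu≤ (app≤ L≤ a≤)))
    with ⊢-mono Π apx (nf≤ (neu≤ L≤)) | ⊢ₘ-mono Π′ apx′ a≤
  ... | Π₁ , apx₁ | Π₁′ , apx₁′ = →E Π₁ Π₁′ Θ≈ , L , c , apx₁ , apx₁′ , refl

  ⊢ₘ-mono : ∀ {Γ a a′ c A} (Π : Γ ⊢ₘ a ∶ A) → ApxM Π c → a ≤ᵃ a′ →
    Σ (Γ ⊢ₘ a′ ∶ A) λ Π′ → ApxM Π′ c
  ⊢ₘ-mono (m ps F Γ≈ A≈) (cs , apxs , lub) a≤ with Fam-mono F apxs a≤
  ... | F′ , apxs′ = m ps F′ Γ≈ A≈ , cs , apxs′ , lub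

  Fam-mono : ∀ {a a′ ps cs} (F : Fam a ps) → ApxF F cs → a ≤ᵃ a′ →
    Σ (Fam a′ ps) λ F′ → ApxF F′ cs
  Fam-mono [] refl _ = [] , refl
  Fam-mono (Π ∷ F) (c , cs , apx , apxs , refl) a≤
    with ⊢-mono Π apx a≤ | Fam-mono F apxs a≤
  ... | Π′ , apx′ | F′ , apxs′ = Π′ ∷ F′ , c , cs , apx′ , apxs′ , refl

mutual
  T-sound : ∀ {a Γ σ} → T a Γ σ → Γ ⊢ a ∶ σ ≫ a
  T-sound (Abs t Γx≡[]) = →I-fresh Γx≡[] ≈ᵉ-refl (T-sound t)
  T-sound (Head h _ Γ≈ τ≈) with H-sound h
  ... | Π , apx = ⊢-resp-≈ Π apx (≈ᵉ-sym Γ≈) (≈ᵗ-sym τ≈)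

  H-sound : ∀ {x ρ L Γ τ} → H x ρ L Γ τ →
    (Γ +ᵉ (x ∶ᵉ [ ρ ])) ⊢ nf (neu L) ∶ τ ≫ nf (neu L)
  H-sound {x = x} (Head0 Γ≈∅) = var (+ᵉ-congʳ (x ∶ᵉ _) Γ≈∅) , refl
  H-sound {x = x} {ρ} (Head>0 {L = L} {b} {Γ₁ = Γ₁} {Γ₂} Γ≈ _ h ti)
    with H-sound h | TI-sound ti
  ... | Π , apx | Π′ , apx′ =
    →E Π Π′ (≈ᵉ-trans (+ᵉ-congʳ (x ∶ᵉ [ ρ ]) Γ≈) (+ᵉ-swapʳ Γ₁ Γ₂ (x ∶ᵉ [ ρ ]))) ,
    L , b , apx , apx′ , refl

  TI-sound : ∀ {b Γ A} → TI b Γ A → Σ (Γ ⊢ₘ b ∶ A) λ Π → ApxM Π b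
  TI-sound {Γ = Γ} {A} (Union ps ts lub Γ≈ A≈) with TFam-sound ts (proj₁ lub)
  ... | F , apxs =
    m (map proj₂ ps) F
      (subst (λ Δs → Γ ≈ᵉ sumᵉ Δs) (map-∘ ps) Γ≈)
      (subst (A ≈ᵐ_) (map-∘ ps) A≈) ,
    map proj₁ ps , apxs , lub

  TFam-sound : ∀ {b ps} → TFam ps → All (_≤ᵃ b) (map proj₁ ps) →
    Σ (Fam b (map proj₂ ps)) λ F → ApxF F (map proj₁ ps)
  TFam-sound [] [] = [] , refl
  TFam-sound (t ∷ ts) (a≤ ∷ as≤) with T-sound t | TFam-sound ts as≤
  ... | Π , apx | F , apxs with ⊢-mono Π apx a≤
  ... | Π′ , apx′ = Π′ ∷ F , _ , _ , apx′ , apxs , refl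

T-resp-≈ᵉ : ∀ {a Γ Γ′ σ} → T a Γ σ → Γ ≈ᵉ Γ′ → T a Γ′ σ
T-resp-≈ᵉ {Γ′ = Γ′} (Abs {x = x} t Γx≡[]) Γ≈ =
  Abs (T-resp-≈ᵉ t (+ᵉ-congʳ _ Γ≈)) (≈ᵐ-[] (subst (_≈ᵐ Γ′ x) Γx≡[] (Γ≈ x)))
T-resp-≈ᵉ (Head h en Γ≈′ τ≈) Γ≈ = Head h en (≈ᵉ-trans (≈ᵉ-sym Γ≈) Γ≈′) τ≈

TI-resp-≈ᵐ : ∀ {b Γ A A′} → TI b Γ A → A ≈ᵐ A′ → TI b Γ A′
TI-resp-≈ᵐ (Union ps ts lub Γ≈ A≈) A≈A′ = Union ps ts lub Γ≈ (≈ᵐ-trans (≈ᵐ-sym A≈A′) A≈)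

Ends-cod : ∀ {ρ A τ} → Ends ρ (A ⇒ τ) → Ends ρ τ
Ends-cod here = there here
Ends-cod (there e) = there (Ends-cod e)

mutual
  ⊢-complete : ∀ {Γ a b σ} (Π : Γ ⊢ a ∶ σ) → Apx Π b → T b Γ σ
  ⊢-complete (var Γ≈) refl = Head (Head0 ≈ᵉ-refl) here Γ≈ ≈ᵗ-refl
  ⊢-complete {Γ = Γ} (→I {Γ = Δ} {x = x} Π Γ≈Δ∖x) (_ , apx , refl) =
    Abs (T-resp-≈ᵉ (⊢-complete Π apx) Δ≈) Γx≡[]
    where
    Γx≡[] : Γ x ≡ []
    Γx≡[] = ≈ᵐ-[] (≈ᵐ-sym (subst₂ _≈ᵐ_ refl (∖-at Δ x) (Γ≈Δ∖x x)))

    Δ≈ : Δ ≈ᵉ (Γ +ᵉ (x ∶ᵉ Δ x))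
    Δ≈ = ≈ᵉ-trans (∖-+ᵉ-∶ᵉ {Δ} {x} ≈ᵐ-refl) (+ᵉ-congʳ (x ∶ᵉ Δ x) (≈ᵉ-sym Γ≈Δ∖x))
  ⊢-complete (→E {Δ = Δ} Π Π′ Θ≈) (_ , _ , apx , apx′ , refl)
    with ⊢-complete Π apx
  ... | Head {x = x} {ρ} {Γ₀} h en Γ≈ (arr≈ A≈ τ≈) =
    Head (Head>0 ≈ᵉ-refl en h (TI-resp-≈ᵐ (⊢ₘ-complete Π′ apx′) A≈)) (Ends-cod en)
      (≈ᵉ-trans Θ≈ (≈ᵉ-trans (+ᵉ-congʳ Δ Γ≈) (+ᵉ-swapʳ Γ₀ (x ∶ᵉ [ ρ ]) Δ)))
      τ≈

  ⊢ₘ-complete : ∀ {Γ a c A} (Π : Γ ⊢ₘ a ∶ A) → ApxM Π c → TI c Γ A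
  ⊢ₘ-complete {Γ = Γ} {A = A} (m ps F Γ≈ A≈) (cs , apxs , lub)
    with Fam-complete F apxs
  ... | qs , ts , refl , refl =
    Union qs ts lub
      (subst (λ Δs → Γ ≈ᵉ sumᵉ Δs) (sym (map-∘ qs)) Γ≈)
      (subst (A ≈ᵐ_) (sym (map-∘ qs)) A≈)

  Fam-complete : ∀ {a ps cs} (F : Fam a ps) → ApxF F cs →
    Σ (List (ANF × Env × Ty)) λ qs → TFam qs × map proj₁ qs ≡ cs × map proj₂ qs ≡ ps
  Fam-complete [] refl = [] , [] , refl , refl
  Fam-complete (_∷_ {Δ} {σ} Π F) (c , _ , apx , apxs , refl) with Fam-complete F apxs
  ... | qs , ts , refl , refl = (c , Δ , σ) ∷ qs , ⊢-complete Π apx ∷ ts , refl , refl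

lemma3p18 : (a : ANF) (Γ : Env) (σ : Ty) → FinSupp Γ →
    T a Γ σ ⇔ Σ (Γ ⊢ a ∶ σ) (λ Π → Apx Π a)
lemma3p18 a Γ σ _ = mk⇔ T-sound (λ (Π , apx) → ⊢-complete Π apx)
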